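{- Let $A\in\mathcal{M}_{r\times m}(\mathbb{Z})$ and let $\mathcal{H}_n$ be the $m$-uniform multi-hypergraph with vertex set $[n]$ whose edge multiset is $\{\!\{\{x_1,\dots,x_m\}:(x_1,\dots,x_m)\in\mathcal{S}_0(A)\cap[n]^m\}\!\}$ (one edge for each proper solution). Then for every $1\le\ell\le m$, \[ \Delta_\ell(\mathcal{H}_n)\le \ell!\,m^\ell\max_{Q\subseteq[m],\,|Q|=\ell} n^{(m-\mathrm{rank}(A))-(|Q|-r_Q)}. \]
   Context: $[n]=\{1,\dots,n\}$; $\mathcal{S}_0(A)$ is the set of $\mathbf{x}\in\mathbb{Z}^m$ with $A\mathbf{x}^T=\mathbf{0}$ and pairwise distinct entries. For a vertex set $B$, $\deg_{\mathcal{H}}(B)$ is the number of edges (counted with multiplicity) containing $B$, and $\Delta_\ell(\mathcal{H})=\max\{\deg_{\mathcal{H}}(B):|B|=\ell\}$. For $Q\subseteq[m]$, $A^{\bar Q}$ is the submatrix of $A$ formed by the columns indexed by $[m]\setminus Q$ (the empty matrix has rank $0$) and $r_Q=\mathrm{rank}(A)-\mathrm{rank}(A^{\bar Q})$. -}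

module Defs where

open import Data.Nat as ℕ using (ℕ; zero; suc; _∸_; _⊔_; _^_)
open import Data.Nat.Properties as ℕP using ()
open import Data.Integer as ℤ using (ℤ; +_; 0ℤ; 1ℤ)
open import Data.Integer.Properties as ℤP using ()
open import Data.Fin using (Fin; toℕ; punchIn) renaming (zero to fzero; suc to fsuc)
open import Data.Fin.Properties using (all?; any?)
import Data.Fin.Properties as FinP
open import Data.Fin.Subset using (Subset; _∈_; ∣_∣; ⊤; ∁)
open import Data.Fin.Subset.Properties using (_∈?_)
open import Data.Bool using (Bool; true; false; _∧_; not; T?)
open import Data.List as List using (List; []; _∷_; [_]; map; concatMap; filter; foldr; length; allFin)
import Data.Bool.ListAction as BLA
open import Data.Vec as Vec using (Vec; lookup)
open import Data.Product using (∃; _×_)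
open import Relation.Binary.PropositionalEquality using (_≡_; _≢_)
open import Relation.Nullary using (Dec; ¬_; ¬?; does)
open import Relation.Unary using (Decidable)
open import Relation.Nullary.Decidable using (_×-dec_; _→-dec_)

Matrix : ℕ → ℕ → Set
Matrix r m = Fin r → Fin m → ℤ

allVecs : ∀ {a} {A : Set a} → List A → (m : ℕ) → List (Vec A m)
allVecs xs zero    = [ Vec.[] ]
allVecs xs (suc m) = concatMap (λ v → map (Vec._∷ v) xs) (allVecs xs m)

ΣFin : (k : ℕ) → (Fin k → ℤ) → ℤ
ΣFin k f = foldr ℤ._+_ 0ℤ (map f (allFin k))

sgn : ℕ → ℤ
sgn zero          = 1ℤ
sgn (suc zero)    = ℤ.- 1ℤ
sgn (suc (suc j)) = sgn j

det : (k : ℕ) → (Fin k → Fin k → ℤ) → ℤ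
det zero    M = 1ℤ
det (suc k) M = ΣFin (suc k) (λ j → sgn (toℕ j) ℤ.* (M fzero j ℤ.* det k (λ i c → M (fsuc i) (punchIn j c))))

minor : ∀ {r m} k → Matrix r m → Vec (Fin r) k → Vec (Fin m) k → Fin k → Fin k → ℤ
minor k A rows cols i j = A (lookup rows i) (lookup cols j)

maximum : List ℕ → ℕ
maximum = foldr _⊔_ 0

-- does A have a nonzero k×k minor using only columns in S?
-- (rows and columns are ranged over by exhaustive enumeration; repeated
--  indices only give zero determinants)
hasNonzeroMinor : ∀ {r m} → Matrix r m → Subset m → ℕ → Bool
hasNonzeroMinor {r} {m} A S k =
  BLA.any (λ rows → BLA.any (λ cols →
      does (all? (λ j → lookup cols j ∈? S)) ∧ not (does (det k (minor k A rows cols) ℤ.≟ 0ℤ)))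
    (allVecs (allFin m) k))
  (allVecs (allFin r) k)

-- rank of the submatrix of A formed by the columns in S
-- (determinantal rank: largest k with a nonzero k×k minor; this is the rank over ℚ)
rankCols : ∀ {r m} → Matrix r m → Subset m → ℕ
rankCols {r} {m} A S = maximum (filter (λ k → T? (hasNonzeroMinor A S k)) (List.upTo (suc m)))

rank : ∀ {r m} → Matrix r m → ℕ
rank {m = m} A = rankCols A ⊤

rQ : ∀ {r m} → Matrix r m → Subset m → ℕ
rQ A Q = rank A ∸ rankCols A (∁ Q)

-- vertex v : Fin n stands for the integer toℕ v + 1 ∈ [n]
val : ∀ {n} → Fin n → ℤ
val v = + suc (toℕ v)

IsProperSolution : ∀ {r m n} → Matrix r m → Vec (Fin n) m → Set
IsProperSolution {r} {m} A x =
  (∀ i → ΣFin m (λ j → A i j ℤ.* val (lookup x j)) ≡ 0ℤ) ×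
  (∀ i j → i ≢ j → lookup x i ≢ lookup x j)

EdgeContains : ∀ {m n} → Vec (Fin n) m → Subset n → Set
EdgeContains {m} x B = ∀ v → v ∈ B → ∃ λ j → lookup x j ≡ v

properSolution? : ∀ {r m n} (A : Matrix r m) → Decidable (IsProperSolution {n = n} A)
properSolution? {r} {m} A x =
  all? (λ i → ΣFin m (λ j → A i j ℤ.* val (lookup x j)) ℤ.≟ 0ℤ) ×-dec
  all? (λ i → all? (λ j → ¬? (i FinP.≟ j) →-dec ¬? (lookup x i FinP.≟ lookup x j)))

edgeContains? : ∀ {m n} (B : Subset n) → Decidable (λ (x : Vec (Fin n) m) → EdgeContains x B)
edgeContains? B x = all? (λ v → (v ∈? B) →-dec any? (λ j → lookup x j FinP.≟ v))

deg : ∀ {r m} → Matrix r m → (n : ℕ) → Subset n → ℕ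
deg {m = m} A n B =
  length (filter (edgeContains? B) (filter (properSolution? A) (allVecs (allFin n) m)))

maxTerm : ∀ {r m} → Matrix r m → ℕ → ℕ → ℕ
maxTerm {m = m} A n ℓ =
  maximum (map (λ Q → n ^ ((m ∸ rank A) ∸ (∣ Q ∣ ∸ rQ A Q)))
               (filter (λ Q → ∣ Q ∣ ℕ.≟ ℓ) (allVecs (true ∷ false ∷ []) m)))

-- An edge through B is a proper solution x together with the positions κ ∈ [m]^ℓ at which the
-- vertices of B occur in x, so it suffices to bound each of the at most m^ℓ fibres. In a fibre all
-- solutions agree on the ℓ coordinates Q = κ(B). Take a nonsingular minor of A on rank(A^{∁Q})
-- columns C outside Q: two solutions that also agree outside Q ∪ C differ by a kernel vector of A
-- supported on C, which vanishes by Cramer's rule. Hence a fibre has at most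
-- n^{m − ℓ − rank(A^{∁Q})} = n^{(m − rank A) − (ℓ − r_Q)} elements.

module Submission where

open import Defs
open import Data.Bool using (true; false; T; T?; not)
open import Data.Bool.Properties using (T-≡; T-∧)
open import Data.Empty using (⊥-elim)
open import Data.Fin as F using (Fin; toℕ; punchIn; punchOut) renaming (zero to fzero; suc to fsuc)
import Data.Fin.Properties as FP
open import Data.Fin.Subset using (Subset; ∣_∣; ⊤; ∁) renaming (_∈_ to _∈ₛ_)
open import Data.Fin.Subset.Properties using (x∈∁p⇒x∉p) renaming (_∈?_ to _∈ₛ?_)
open import Data.List as List using (List; []; _∷_; length; map; filter; concatMap; _++_; allFin)
import Data.List.Properties as LP
open import Data.List.Membership.Propositional using (_∈_; _∉_; find)
import Data.List.Membership.Propositional.Properties as MP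
open import Data.List.Relation.Binary.Disjoint.Propositional using (Disjoint)
open import Data.List.Relation.Binary.Subset.Propositional using (_⊆_)
open import Data.List.Relation.Unary.All as All using (All; []; _∷_)
import Data.List.Relation.Unary.All.Properties as AllP
open import Data.List.Relation.Unary.AllPairs using ([]; _∷_)
open import Data.List.Relation.Unary.Any as Any using (Any; here; there)
import Data.List.Relation.Unary.Any.Properties as AnyP
open import Data.List.Relation.Unary.Unique.Propositional using (Unique)
import Data.List.Relation.Unary.Unique.Propositional.Properties as UniqueP
open import Data.Integer as ℤ using (ℤ; 0ℤ)
open import Data.Nat as ℕ using (ℕ; zero; suc; z≤n; _≤_; _^_; _∸_; _!)
import Data.Nat.Properties as ℕP
open import Data.Product using (∃; _×_; _,_; proj₁; proj₂)
open import Data.Sum using (_⊎_; inj₁; inj₂; [_,_]′)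
open import Data.Vec as Vec using (Vec)
import Data.Vec.Properties as VecP
open import Data.Vec.Functional using (updateAt)
open import Data.Vec.Functional.Properties using (updateAt-updates; updateAt-minimal; updateAt-id-local)
open import Function using (_∘_; id; const)
open import Function.Bundles using (Equivalence)
open import Function.Definitions using (Injective)
open import Relation.Binary.Definitions using (DecidableEquality; tri<; tri≈; tri>)
open import Relation.Binary.PropositionalEquality
open import Relation.Nullary using (Dec; does; yes; no; ¬_)
open import Relation.Nullary.Decidable using (dec-true; ¬?; _×-dec_)

lookup-extensional : ∀ {X : Set} {k} {x y : Vec X k} → (∀ j → Vec.lookup x j ≡ Vec.lookup y j) → x ≡ y
lookup-extensional {x = x} {y} x≗y =
  trans (sym (VecP.tabulate∘lookup x)) (trans (VecP.tabulate-cong x≗y) (VecP.tabulate∘lookup y))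

-- ℤ's operators are opened only in here, so that _+_ and _*_ denote those of ℕ afterwards.
module IntegerLinearAlgebra where

  open import Data.Integer using (ℤ; 0ℤ; 1ℤ; _+_; _*_; -_; _-_)
  import Data.Integer.Properties as ℤP
  open import Data.Integer.Tactic.RingSolver using (solve-∀)
  open import Algebra.Properties.AbelianGroup ℤP.+-0-abelianGroup using (inverseʳ-unique)
  open import Algebra.Properties.Semiring.Sum ℤP.+-*-semiring
    using (sum; sum-cong-≗; sum-replicate-zero; sum-remove; ∑-distrib-+; *-distribˡ-sum)

  ΣFin≡sum : ∀ k (f : Fin k → ℤ) → ΣFin k f ≡ sum f
  ΣFin≡sum zero    f = refl
  ΣFin≡sum (suc k) f = cong (f fzero +_) (trans
    (cong (List.foldr _+_ 0ℤ) (trans (LP.map-tabulate fsuc f) (sym (LP.map-tabulate id (f ∘ fsuc)))))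
    (ΣFin≡sum k (f ∘ fsuc)))

  sum-zero : ∀ {k} {f : Fin k → ℤ} → (∀ j → f j ≡ 0ℤ) → sum f ≡ 0ℤ
  sum-zero {k} f≗0 = trans (sum-cong-≗ f≗0) (sum-replicate-zero k)

  sum-single : ∀ {k} {f : Fin k → ℤ} (a : Fin k) → (∀ j → j ≢ a → f j ≡ 0ℤ) → sum f ≡ f a
  sum-single {suc k} {f} a vanish = begin
    sum f                          ≡⟨ sum-remove {i = a} f ⟩
    f a + sum (f ∘ punchIn a)      ≡⟨ cong (f a +_) (sum-zero (λ j → vanish _ (FP.punchInᵢ≢i a j))) ⟩
    f a + 0ℤ                       ≡⟨ ℤP.+-identityʳ (f a) ⟩
    f a                            ∎
    where open ≡-Reasoning

  sum-pair : ∀ {k} {f : Fin k → ℤ} (a b : Fin k) → a ≢ b →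
             (∀ j → j ≢ a → j ≢ b → f j ≡ 0ℤ) → sum f ≡ f a + f b
  sum-pair {suc k} {f} a b a≢b vanish = begin
    sum f                          ≡⟨ sum-remove {i = a} f ⟩
    f a + sum (f ∘ punchIn a)      ≡⟨ cong (f a +_) (sum-single (punchOut a≢b) vanish′) ⟩
    f a + f (punchIn a (punchOut a≢b)) ≡⟨ cong (λ c → f a + f c) (FP.punchIn-punchOut a≢b) ⟩
    f a + f b                      ∎
    where
    open ≡-Reasoning
    vanish′ : ∀ j → j ≢ punchOut a≢b → f (punchIn a j) ≡ 0ℤ
    vanish′ j j≢ = vanish _ (FP.punchInᵢ≢i a j)
      (λ e → j≢ (FP.punchIn-injective a j _ (trans e (sym (FP.punchIn-punchOut a≢b)))))

  sum-reindex : ∀ {k m} (c : Fin k → Fin m) (h : Fin m → ℤ) → Injective _≡_ _≡_ c →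
                (∀ j → (∀ t → c t ≢ j) → h j ≡ 0ℤ) → sum h ≡ sum (h ∘ c)
  sum-reindex {zero}          c h _     vanish = sum-zero (λ j → vanish j (λ ()))
  sum-reindex {suc k} {zero}  c _ _     _      with () ← c fzero
  sum-reindex {suc k} {suc m} c h c-inj vanish = begin
    sum h                                  ≡⟨ sum-remove {i = c₀} h ⟩
    h c₀ + sum (h ∘ punchIn c₀)            ≡⟨ cong (h c₀ +_) (sum-reindex c′ (h ∘ punchIn c₀) c′-inj vanish′) ⟩
    h c₀ + sum (h ∘ punchIn c₀ ∘ c′)       ≡⟨ cong (h c₀ +_) (sum-cong-≗ (λ t → cong h (FP.punchIn-punchOut (c₀≢c t)))) ⟩
    sum (h ∘ c)                            ∎
    where
    open ≡-Reasoning
    c₀ : Fin (suc m)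
    c₀ = c fzero
    c₀≢c : ∀ t → c₀ ≢ c (fsuc t)
    c₀≢c t e with () ← c-inj e
    c′ : Fin k → Fin m
    c′ t = punchOut (c₀≢c t)
    c′-inj : Injective _≡_ _≡_ c′
    c′-inj e = FP.suc-injective (c-inj (FP.punchOut-injective (c₀≢c _) (c₀≢c _) e))
    vanish′ : ∀ j → (∀ t → c′ t ≢ j) → h (punchIn c₀ j) ≡ 0ℤ
    vanish′ j j∉c′ = vanish _ λ
      { fzero e → FP.punchInᵢ≢i c₀ j (sym e)
      ; (fsuc t) e → j∉c′ t (FP.punchIn-injective c₀ _ j (trans (FP.punchIn-punchOut (c₀≢c t)) e)) }

  Mat : ℕ → Set
  Mat k = Fin k → Fin k → ℤ

  cofactor : ∀ {k} → Mat (suc k) → Fin (suc k) → Mat k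
  cofactor M j i c = M (fsuc i) (punchIn j c)

  expansionTerm : ∀ {k} → Mat (suc k) → Fin (suc k) → ℤ
  expansionTerm {k} M j = sgn (toℕ j) * (M fzero j * det k (cofactor M j))

  det-expand : ∀ {k} (M : Mat (suc k)) → det (suc k) M ≡ sum (expansionTerm M)
  det-expand {k} M = ΣFin≡sum (suc k) (expansionTerm M)

  det-cong : ∀ k {M N : Mat k} → (∀ i j → M i j ≡ N i j) → det k M ≡ det k N
  det-cong zero    M≗N = refl
  det-cong (suc k) {M} {N} M≗N = begin
    det (suc k) M              ≡⟨ det-expand M ⟩
    sum (expansionTerm M)      ≡⟨ sum-cong-≗ termEq ⟩
    sum (expansionTerm N)      ≡⟨ det-expand N ⟨
    det (suc k) N              ∎
    where
    open ≡-Reasoning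
    termEq : ∀ j → expansionTerm M j ≡ expansionTerm N j
    termEq j = cong₂ (λ x y → sgn (toℕ j) * (x * y)) (M≗N fzero j) (det-cong k (λ i c → M≗N _ _))

  det-linearCol : ∀ k (M N N′ : Mat k) (s : Fin k) (a b : ℤ) →
    (∀ i j → j ≢ s → M i j ≡ N i j) → (∀ i j → j ≢ s → M i j ≡ N′ i j) →
    (∀ i → M i s ≡ a * N i s + b * N′ i s) → det k M ≡ a * det k N + b * det k N′
  det-linearCol (suc k) M N N′ s a b offN offN′ onS = begin
    det (suc k) M                                              ≡⟨ det-expand M ⟩
    sum (expansionTerm M)                                      ≡⟨ sum-cong-≗ termLinear ⟩
    sum (λ j → a * expansionTerm N j + b * expansionTerm N′ j)
      ≡⟨ ∑-distrib-+ (λ j → a * expansionTerm N j) (λ j → b * expansionTerm N′ j) ⟩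
    sum (λ j → a * expansionTerm N j) + sum (λ j → b * expansionTerm N′ j)
      ≡⟨ cong₂ _+_ (*-distribˡ-sum a (expansionTerm N)) (*-distribˡ-sum b (expansionTerm N′)) ⟨
    a * sum (expansionTerm N) + b * sum (expansionTerm N′)
      ≡⟨ cong₂ (λ x y → a * x + b * y) (det-expand N) (det-expand N′) ⟨
    a * det (suc k) N + b * det (suc k) N′                     ∎
    where
    open ≡-Reasoning
    linearEntry : ∀ a b σ x y d → σ * ((a * x + b * y) * d) ≡ a * (σ * (x * d)) + b * (σ * (y * d))
    linearEntry = solve-∀
    linearCofactor : ∀ a b σ x d e → σ * (x * (a * d + b * e)) ≡ a * (σ * (x * d)) + b * (σ * (x * e))
    linearCofactor = solve-∀
    termLinear : ∀ j → expansionTerm M j ≡ a * expansionTerm N j + b * expansionTerm N′ j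
    termLinear j with j FP.≟ s
    ... | yes refl = begin
      sgn (toℕ j) * (M fzero j * det k (cofactor M j))
        ≡⟨ cong (λ x → sgn (toℕ j) * (x * det k (cofactor M j))) (onS fzero) ⟩
      sgn (toℕ j) * ((a * N fzero j + b * N′ fzero j) * det k (cofactor M j))
        ≡⟨ linearEntry a b (sgn (toℕ j)) (N fzero j) (N′ fzero j) (det k (cofactor M j)) ⟩
      a * (sgn (toℕ j) * (N fzero j * det k (cofactor M j))) + b * (sgn (toℕ j) * (N′ fzero j * det k (cofactor M j)))
        ≡⟨ cong₂ (λ d d′ → a * (sgn (toℕ j) * (N fzero j * d)) + b * (sgn (toℕ j) * (N′ fzero j * d′)))
                 (det-cong k (λ i c → offN _ _ (FP.punchInᵢ≢i j c))) (det-cong k (λ i c → offN′ _ _ (FP.punchInᵢ≢i j c))) ⟩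
      a * expansionTerm N j + b * expansionTerm N′ j ∎
    ... | no j≢s = begin
      sgn (toℕ j) * (M fzero j * det k (cofactor M j))
        ≡⟨ cong₂ (λ x d → sgn (toℕ j) * (x * d)) (offN fzero j j≢s) cofactorLinear ⟩
      sgn (toℕ j) * (N fzero j * (a * det k (cofactor N j) + b * det k (cofactor N′ j)))
        ≡⟨ linearCofactor a b (sgn (toℕ j)) (N fzero j) (det k (cofactor N j)) (det k (cofactor N′ j)) ⟩
      a * expansionTerm N j + b * (sgn (toℕ j) * (N fzero j * det k (cofactor N′ j)))
        ≡⟨ cong (λ x → a * expansionTerm N j + b * (sgn (toℕ j) * (x * det k (cofactor N′ j))))
                (trans (sym (offN fzero j j≢s)) (offN′ fzero j j≢s)) ⟩
      a * expansionTerm N j + b * expansionTerm N′ j ∎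
      where
      s′ : Fin k
      s′ = punchOut j≢s
      punchIn-s′ : punchIn j s′ ≡ s
      punchIn-s′ = FP.punchIn-punchOut j≢s
      off : ∀ c → c ≢ s′ → punchIn j c ≢ s
      off c c≢s′ e = c≢s′ (FP.punchIn-injective j c s′ (trans e (sym punchIn-s′)))
      cofactorLinear : det k (cofactor M j) ≡ a * det k (cofactor N j) + b * det k (cofactor N′ j)
      cofactorLinear = det-linearCol k (cofactor M j) (cofactor N j) (cofactor N′ j) s′ a b
        (λ i c c≢ → offN _ _ (off c c≢)) (λ i c c≢ → offN′ _ _ (off c c≢))
        (λ i → subst (λ t → M (fsuc i) t ≡ a * N (fsuc i) t + b * N′ (fsuc i) t) (sym punchIn-s′) (onS (fsuc i)))

  setCol : ∀ {k} → Mat k → Fin k → (Fin k → ℤ) → Mat k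
  setCol M s u i = updateAt (M i) s (const (u i))

  setCol-same : ∀ {k} (M : Mat k) s u i → setCol M s u i s ≡ u i
  setCol-same M s u i = updateAt-updates s (M i)

  setCol-other : ∀ {k} (M : Mat k) s u i {j} → j ≢ s → setCol M s u i j ≡ M i j
  setCol-other M s u i {j} = updateAt-minimal j s (M i)

  setCol-cong : ∀ {k} {M N : Mat k} s {u v} → (∀ i j → M i j ≡ N i j) → (∀ i → u i ≡ v i) →
                ∀ i j → setCol M s u i j ≡ setCol N s v i j
  setCol-cong {M = M} {N} s {u} {v} M≗N u≗v i j with j FP.≟ s
  ... | yes refl = trans (setCol-same M s u i) (trans (u≗v i) (sym (setCol-same N s v i)))
  ... | no j≢s   = trans (setCol-other M s u i j≢s) (trans (M≗N i j) (sym (setCol-other N s v i j≢s)))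

  setCol-col : ∀ {k} (M : Mat k) s i j → setCol M s (λ i → M i s) i j ≡ M i j
  setCol-col M s i = updateAt-id-local s (M i) refl

  setCol-comm : ∀ {k} (M : Mat k) {p q} → p ≢ q → ∀ u v i j →
                setCol (setCol M q v) p u i j ≡ setCol (setCol M p u) q v i j
  setCol-comm M {p} {q} p≢q u v i j with j FP.≟ p | j FP.≟ q
  ... | yes refl | yes refl = ⊥-elim (p≢q refl)
  ... | yes refl | no j≢q   = trans (setCol-same (setCol M q v) p u i)
    (sym (trans (setCol-other (setCol M p u) q v i j≢q) (setCol-same M p u i)))
  ... | no j≢p   | yes refl = trans (setCol-other (setCol M q v) p u i j≢p)
    (trans (setCol-same M q v i) (sym (setCol-same (setCol M p u) q v i)))
  ... | no j≢p   | no j≢q   = trans (setCol-other (setCol M q v) p u i j≢p) (trans (setCol-other M q v i j≢q)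
    (sym (trans (setCol-other (setCol M p u) q v i j≢q) (setCol-other M p u i j≢p))))

  det-setCol-linear : ∀ k (M : Mat k) s a b u v →
    det k (setCol M s (λ i → a * u i + b * v i)) ≡ a * det k (setCol M s u) + b * det k (setCol M s v)
  det-setCol-linear k M s a b u v =
    det-linearCol k (setCol M s w) (setCol M s u) (setCol M s v) s a b
    (λ i j j≢s → trans (setCol-other M s w i j≢s) (sym (setCol-other M s u i j≢s)))
    (λ i j j≢s → trans (setCol-other M s w i j≢s) (sym (setCol-other M s v i j≢s)))
    (λ i → trans (setCol-same M s w i)
       (sym (cong₂ (λ x y → a * x + b * y) (setCol-same M s u i) (setCol-same M s v i))))
    where
    w : Fin k → ℤ
    w i = a * u i + b * v i

  det-setCol-+ : ∀ k (M : Mat k) s u v →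
    det k (setCol M s (λ i → u i + v i)) ≡ det k (setCol M s u) + det k (setCol M s v)
  det-setCol-+ k M s u v = begin
    det k (setCol M s (λ i → u i + v i))
      ≡⟨ det-cong k (setCol-cong s (λ _ _ → refl) λ i → cong₂ _+_ (ℤP.*-identityˡ (u i)) (ℤP.*-identityˡ (v i))) ⟨
    det k (setCol M s (λ i → 1ℤ * u i + 1ℤ * v i))
      ≡⟨ det-setCol-linear k M s 1ℤ 1ℤ u v ⟩
    1ℤ * det k (setCol M s u) + 1ℤ * det k (setCol M s v)
      ≡⟨ cong₂ _+_ (ℤP.*-identityˡ (det k (setCol M s u))) (ℤP.*-identityˡ (det k (setCol M s v))) ⟩
    det k (setCol M s u) + det k (setCol M s v)
      ∎
    where open ≡-Reasoning

  det-setCol-* : ∀ k (M : Mat k) s a u →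
    det k (setCol M s (λ i → a * u i)) ≡ a * det k (setCol M s u)
  det-setCol-* k M s a u = begin
    det k (setCol M s (λ i → a * u i))
      ≡⟨ det-cong k (setCol-cong s (λ _ _ → refl) λ i → ℤP.+-identityʳ (a * u i)) ⟨
    det k (setCol M s (λ i → a * u i + 0ℤ * u i))
      ≡⟨ det-setCol-linear k M s a 0ℤ u u ⟩
    a * det k (setCol M s u) + 0ℤ * det k (setCol M s u)
      ≡⟨ ℤP.+-identityʳ (a * det k (setCol M s u)) ⟩
    a * det k (setCol M s u)
      ∎
    where open ≡-Reasoning

  det-setCol-0 : ∀ k (M : Mat k) s → det k (setCol M s (const 0ℤ)) ≡ 0ℤ
  det-setCol-0 k M s = det-setCol-* k M s 0ℤ (const 0ℤ)

  det-setCol-sum : ∀ k (M : Mat k) s {K} (F : Fin K → Fin k → ℤ) →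
    det k (setCol M s (λ i → sum (λ t → F t i))) ≡ sum (λ t → det k (setCol M s (F t)))
  det-setCol-sum k M s {zero}  F = det-setCol-0 k M s
  det-setCol-sum k M s {suc K} F = trans (det-setCol-+ k M s (F fzero) (λ i → sum (λ t → F (fsuc t) i)))
    (cong (det k (setCol M s (F fzero)) +_) (det-setCol-sum k M s (F ∘ fsuc)))

  alternating⇒antisymmetric : ∀ {A : Set} (_⊕_ : A → A → A) (f : A → A → ℤ) →
    (∀ u v w → f (u ⊕ v) w ≡ f u w + f v w) → (∀ u v w → f u (v ⊕ w) ≡ f u v + f u w) →
    (∀ u → f u u ≡ 0ℤ) → ∀ u v → f v u ≡ - f u v
  alternating⇒antisymmetric _⊕_ f additiveˡ additiveʳ alternating u v =
    inverseʳ-unique (f u v) (f v u) (begin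
      f u v + f v u                           ≡⟨ solve (f u v) (f v u) ⟩
      (0ℤ + f u v) + (f v u + 0ℤ)             ≡⟨ cong₂ (λ x y → (x + f u v) + (f v u + y)) (alternating u) (alternating v) ⟨
      (f u u + f u v) + (f v u + f v v)       ≡⟨ cong₂ _+_ (additiveʳ u u v) (additiveʳ v u v) ⟨
      f u (u ⊕ v) + f v (u ⊕ v)               ≡⟨ additiveˡ u v (u ⊕ v) ⟨
      f (u ⊕ v) (u ⊕ v)                       ≡⟨ alternating (u ⊕ v) ⟩
      0ℤ                                      ∎)
    where
    open ≡-Reasoning
    solve : ∀ b c → b + c ≡ (0ℤ + b) + (c + 0ℤ)
    solve = solve-∀

  sgn-suc : ∀ n → sgn (suc n) ≡ - sgn n
  sgn-suc zero          = refl
  sgn-suc (suc zero)    = refl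
  sgn-suc (suc (suc n)) = sgn-suc n

  punchIn-successive : ∀ {n} {a b : Fin (suc n)} → toℕ b ≡ suc (toℕ a) → ∀ c →
    punchIn b c ≡ punchIn a c ⊎ (punchIn b c ≡ a × punchIn a c ≡ b)
  punchIn-successive {a = fzero}  {fsuc fzero}    _ fzero    = inj₂ (refl , refl)
  punchIn-successive {a = fzero}  {fsuc fzero}    _ (fsuc c) = inj₁ refl
  punchIn-successive {a = fsuc a} {fsuc b}        _ fzero    = inj₁ refl
  punchIn-successive {a = fsuc a} {fsuc b}        e (fsuc c) with punchIn-successive (ℕP.suc-injective e) c
  ... | inj₁ eq         = inj₁ (cong fsuc eq)
  ... | inj₂ (eq , eq′) = inj₂ (cong fsuc eq , cong fsuc eq′)

  punchOut-successive : ∀ {n} {j a b : Fin (suc n)} (j≢a : j ≢ a) (j≢b : j ≢ b) →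
    toℕ b ≡ suc (toℕ a) → toℕ (punchOut j≢b) ≡ suc (toℕ (punchOut j≢a))
  punchOut-successive {j = fzero} {fzero}          j≢a _   _ = ⊥-elim (j≢a refl)
  punchOut-successive {j = fzero} {fsuc a} {fsuc b} _   _   e = ℕP.suc-injective e
  punchOut-successive {suc n} {fsuc fzero}    {fzero} {fsuc fzero} _ j≢b _ = ⊥-elim (j≢b refl)
  punchOut-successive {suc (suc n)} {fsuc (fsuc j)} {fzero} {fsuc fzero} _ _ _ = refl
  punchOut-successive {suc n} {fsuc j} {fsuc a} {fsuc b} j≢a j≢b e =
    cong suc (punchOut-successive (j≢a ∘ cong fsuc) (j≢b ∘ cong fsuc) (ℕP.suc-injective e))

  det-successiveEqualCols : ∀ k (M : Mat k) (a b : Fin k) → toℕ b ≡ suc (toℕ a) →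
    (∀ i → M i a ≡ M i b) → det k M ≡ 0ℤ
  det-successiveEqualCols (suc k) M a b successive a≡b = begin
    det (suc k) M                            ≡⟨ det-expand M ⟩
    sum (expansionTerm M)                    ≡⟨ sum-pair a b a≢b otherTerms ⟩
    expansionTerm M a + expansionTerm M b    ≡⟨ cong₂ (λ σ x → expansionTerm M a + σ * (x * det k (cofactor M b)))
                                                       (trans (cong sgn successive) (sgn-suc (toℕ a))) (sym (a≡b fzero)) ⟩
    expansionTerm M a + (- sgn (toℕ a)) * (M fzero a * det k (cofactor M b))
                                             ≡⟨ cong (λ d → expansionTerm M a + (- sgn (toℕ a)) * (M fzero a * d))
                                                     (det-cong k cofactorsAgree) ⟩
    expansionTerm M a + (- sgn (toℕ a)) * (M fzero a * det k (cofactor M a))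
                                             ≡⟨ cancel (sgn (toℕ a)) (M fzero a * det k (cofactor M a)) ⟩
    0ℤ                                       ∎
    where
    open ≡-Reasoning
    cancel : ∀ σ x → σ * x + (- σ) * x ≡ 0ℤ
    cancel = solve-∀
    a≢b : a ≢ b
    a≢b refl = ℕP.1+n≢n (sym successive)
    otherTerms : ∀ j → j ≢ a → j ≢ b → expansionTerm M j ≡ 0ℤ
    otherTerms j j≢a j≢b = begin
      sgn (toℕ j) * (M fzero j * det k (cofactor M j)) ≡⟨ cong (λ d → sgn (toℕ j) * (M fzero j * d)) cofactorVanishes ⟩
      sgn (toℕ j) * (M fzero j * 0ℤ)                   ≡⟨ cong (sgn (toℕ j) *_) (ℤP.*-zeroʳ (M fzero j)) ⟩
      sgn (toℕ j) * 0ℤ                                 ≡⟨ ℤP.*-zeroʳ (sgn (toℕ j)) ⟩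
      0ℤ                                               ∎
      where
      cofactorVanishes : det k (cofactor M j) ≡ 0ℤ
      cofactorVanishes = det-successiveEqualCols k (cofactor M j) (punchOut j≢a) (punchOut j≢b)
        (punchOut-successive j≢a j≢b successive)
        (λ i → trans (cong (M (fsuc i)) (FP.punchIn-punchOut j≢a))
               (trans (a≡b (fsuc i)) (cong (M (fsuc i)) (sym (FP.punchIn-punchOut j≢b)))))
    cofactorsAgree : ∀ i c → cofactor M b i c ≡ cofactor M a i c
    cofactorsAgree i c with punchIn-successive successive c
    ... | inj₁ eq         = cong (M (fsuc i)) eq
    ... | inj₂ (eq , eq′) = trans (cong (M (fsuc i)) eq) (trans (a≡b (fsuc i)) (cong (M (fsuc i)) (sym eq′)))

  swapCols : ∀ {k} → Mat k → Fin k → Fin k → Mat k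
  swapCols M p q = setCol (setCol M q (λ i → M i p)) p (λ i → M i q)

  det-swapSuccessive : ∀ k (M : Mat k) (p q : Fin k) → toℕ q ≡ suc (toℕ p) →
    det k (swapCols M p q) ≡ - det k M
  det-swapSuccessive k M p q successive =
    trans (alternating⇒antisymmetric _⊕_ f additiveˡ additiveʳ alternating (λ i → M i p) (λ i → M i q))
          (cong -_ (det-cong k restore))
    where
    _⊕_ : (Fin k → ℤ) → (Fin k → ℤ) → Fin k → ℤ
    (u ⊕ v) i = u i + v i
    f : (Fin k → ℤ) → (Fin k → ℤ) → ℤ
    f u v = det k (setCol (setCol M q v) p u)
    p≢q : p ≢ q
    p≢q refl = ℕP.1+n≢n (sym successive)
    additiveˡ : ∀ u v w → f (u ⊕ v) w ≡ f u w + f v w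
    additiveˡ u v w = det-setCol-+ k (setCol M q w) p u v
    additiveʳ : ∀ u v w → f u (v ⊕ w) ≡ f u v + f u w
    additiveʳ u v w = begin
      f u (v ⊕ w)                                                   ≡⟨ det-cong k (setCol-comm M p≢q u (v ⊕ w)) ⟩
      det k (setCol (setCol M p u) q (v ⊕ w))                       ≡⟨ det-setCol-+ k (setCol M p u) q v w ⟩
      det k (setCol (setCol M p u) q v) + det k (setCol (setCol M p u) q w)
        ≡⟨ cong₂ _+_ (det-cong k (setCol-comm M p≢q u v)) (det-cong k (setCol-comm M p≢q u w)) ⟨
      f u v + f u w                                                 ∎
      where open ≡-Reasoning
    alternating : ∀ u → f u u ≡ 0ℤ
    alternating u = det-successiveEqualCols k (setCol (setCol M q u) p u) p q successive λ i →
      trans (setCol-same (setCol M q u) p u i)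
            (sym (trans (setCol-other (setCol M q u) p u i (p≢q ∘ sym)) (setCol-same M q u i)))
    restore : ∀ i j → setCol (setCol M q (λ i → M i q)) p (λ i → M i p) i j ≡ M i j
    restore i j = trans (setCol-cong p {u = λ i → M i p} (setCol-col M q) (λ _ → refl) i j) (setCol-col M p i j)

  det-equalColsAtDistance : ∀ d k (M : Mat k) (s t : Fin k) → suc (toℕ s) ℕ.+ d ≡ toℕ t →
    (∀ i → M i s ≡ M i t) → det k M ≡ 0ℤ
  det-equalColsAtDistance zero    k M s t distance s≡t =
    det-successiveEqualCols k M s t (sym (trans (sym (ℕP.+-identityʳ _)) distance)) s≡t
  -- Swapping column t with its left neighbour t′ negates the determinant and moves the copy of column s closer.
  det-equalColsAtDistance (suc d) (suc k) M s (fsuc t₀) distance s≡t = begin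
    det (suc k) M         ≡⟨ ℤP.neg-involutive (det (suc k) M) ⟨
    - - det (suc k) M     ≡⟨ cong -_ (det-swapSuccessive (suc k) M t′ t successive) ⟨
    - det (suc k) N       ≡⟨ cong -_ (det-equalColsAtDistance d (suc k) N s t′ distance′ s≡t′) ⟩
    - 0ℤ                  ∎
    where
    open ≡-Reasoning
    t t′ : Fin (suc k)
    t = fsuc t₀
    t′ = F.inject₁ t₀
    N : Mat (suc k)
    N = swapCols M t′ t
    distance′ : suc (toℕ s) ℕ.+ d ≡ toℕ t′
    distance′ = trans (ℕP.suc-injective (trans (sym (ℕP.+-suc (suc (toℕ s)) d)) distance)) (sym (FP.toℕ-inject₁ t₀))
    successive : toℕ t ≡ suc (toℕ t′)
    successive = cong suc (sym (FP.toℕ-inject₁ t₀))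
    s≢t′ : s ≢ t′
    s≢t′ eq = ℕP.m≢1+m+n (toℕ s) (trans (cong toℕ eq) (sym distance′))
    s≢t : s ≢ t
    s≢t eq = ℕP.m≢1+m+n (toℕ s) (trans (cong toℕ eq) (sym distance))
    s≡t′ : ∀ i → N i s ≡ N i t′
    s≡t′ i = begin
      N i s                            ≡⟨ setCol-other (setCol M t (λ i → M i t′)) t′ (λ i → M i t) i s≢t′ ⟩
      setCol M t (λ i → M i t′) i s    ≡⟨ setCol-other M t (λ i → M i t′) i s≢t ⟩
      M i s                            ≡⟨ s≡t i ⟩
      M i t                            ≡⟨ setCol-same (setCol M t (λ i → M i t′)) t′ (λ i → M i t) i ⟨
      N i t′                           ∎

  det-equalCols : ∀ k (M : Mat k) (s t : Fin k) → s ≢ t → (∀ i → M i s ≡ M i t) → det k M ≡ 0ℤ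
  det-equalCols k M s t s≢t s≡t with ℕP.<-cmp (toℕ s) (toℕ t)
  ... | tri< s<t _ _ = let (d , distance) = ℕP.m≤n⇒∃[o]m+o≡n s<t in
    det-equalColsAtDistance d k M s t distance s≡t
  ... | tri≈ _ s≡t′ _ = ⊥-elim (s≢t (FP.toℕ-injective s≡t′))
  ... | tri> _ _ t<s = let (d , distance) = ℕP.m≤n⇒∃[o]m+o≡n t<s in
    det-equalColsAtDistance d k M t s distance (sym ∘ s≡t)

  det-setCol-combination : ∀ k (M : Mat k) (w : Fin k → ℤ) s →
    det k (setCol M s (λ i → sum (λ t → M i t * w t))) ≡ w s * det k M
  det-setCol-combination k M w s = begin
    det k (setCol M s (λ i → sum (λ t → M i t * w t)))  ≡⟨ det-setCol-sum k M s (λ t i → M i t * w t) ⟩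
    sum (λ t → det k (setCol M s (λ i → M i t * w t)))  ≡⟨ sum-cong-≗ scaled ⟩
    sum (λ t → w t * det k (setCol M s (λ i → M i t)))  ≡⟨ sum-single s otherCols ⟩
    w s * det k (setCol M s (λ i → M i s))              ≡⟨ cong (w s *_) (det-cong k (setCol-col M s)) ⟩
    w s * det k M                                       ∎
    where
    open ≡-Reasoning
    scaled : ∀ t → det k (setCol M s (λ i → M i t * w t)) ≡ w t * det k (setCol M s (λ i → M i t))
    scaled t = trans (det-cong k (setCol-cong s (λ _ _ → refl) (λ i → ℤP.*-comm (M i t) (w t))))
                     (det-setCol-* k M s (w t) (λ i → M i t))
    otherCols : ∀ t → t ≢ s → w t * det k (setCol M s (λ i → M i t)) ≡ 0ℤ
    otherCols t t≢s = trans (cong (w t *_) (det-equalCols k (setCol M s (λ i → M i t)) s t (t≢s ∘ sym)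
      (λ i → trans (setCol-same M s (λ i → M i t) i) (sym (setCol-other M s (λ i → M i t) i t≢s)))))
      (ℤP.*-zeroʳ (w t))

  det≢0⇒kernel≡0 : ∀ k (M : Mat k) (w : Fin k → ℤ) → det k M ≢ 0ℤ →
    (∀ i → sum (λ t → M i t * w t) ≡ 0ℤ) → ∀ s → w s ≡ 0ℤ
  det≢0⇒kernel≡0 k M w det≢0 Mw≡0 s =
    [ id , (λ det≡0 → ⊥-elim (det≢0 det≡0)) ]′ (ℤP.i*j≡0⇒i≡0∨j≡0 (w s) ws*det≡0)
    where
    open ≡-Reasoning
    ws*det≡0 : w s * det k M ≡ 0ℤ
    ws*det≡0 = begin
      w s * det k M                                        ≡⟨ det-setCol-combination k M w s ⟨
      det k (setCol M s (λ i → sum (λ t → M i t * w t)))  ≡⟨ det-cong k (setCol-cong s (λ _ _ → refl) Mw≡0) ⟩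
      det k (setCol M s (const 0ℤ))                        ≡⟨ det-setCol-0 k M s ⟩
      0ℤ                                                   ∎

  val-injective : ∀ {n} {a b : Fin n} → val a ≡ val b → a ≡ b
  val-injective = FP.toℕ-injective ∘ ℕP.suc-injective ∘ ℤP.+-injective

  module ThroughNonsingularMinor {r m} (A : Matrix r m) {k} (R : Vec (Fin r) k) (C : Vec (Fin m) k)
    (det≢0 : det k (minor k A R C) ≢ 0ℤ) where

    C-injective : Injective _≡_ _≡_ (Vec.lookup C)
    C-injective {t} {u} Ct≡Cu with t FP.≟ u
    ... | yes t≡u = t≡u
    ... | no  t≢u = ⊥-elim (det≢0 (det-equalCols k (minor k A R C) t u t≢u (λ i → cong (A (Vec.lookup R i)) Ct≡Cu)))

    kernel-supportedOnC≡0 : (z : Fin m → ℤ) → (∀ i → sum (λ j → A i j * z j) ≡ 0ℤ) →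
      (∀ j → (∀ t → Vec.lookup C t ≢ j) → z j ≡ 0ℤ) → ∀ j → z j ≡ 0ℤ
    kernel-supportedOnC≡0 z Az≡0 offC j with FP.any? (λ t → Vec.lookup C t FP.≟ j)
    ... | no  j∉C        = offC j (λ t Ct≡j → j∉C (t , Ct≡j))
    ... | yes (t , refl) = det≢0⇒kernel≡0 k (minor k A R C) (z ∘ Vec.lookup C) det≢0 minorKernel t
      where
      minorKernel : ∀ i → sum (λ t → A (Vec.lookup R i) (Vec.lookup C t) * z (Vec.lookup C t)) ≡ 0ℤ
      minorKernel i = trans (sym (sum-reindex (Vec.lookup C) (λ j → A (Vec.lookup R i) j * z j) C-injective
        (λ j j∉C → trans (cong (A (Vec.lookup R i) j *_) (offC j j∉C)) (ℤP.*-zeroʳ (A (Vec.lookup R i) j)))))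
        (Az≡0 (Vec.lookup R i))

    solutions-agreeingOffC : ∀ {n} {x y : Vec (Fin n) m} → IsProperSolution A x → IsProperSolution A y →
      (∀ j → (∀ t → Vec.lookup C t ≢ j) → Vec.lookup x j ≡ Vec.lookup y j) → x ≡ y
    solutions-agreeingOffC {x = x} {y} (Ax≡0 , _) (Ay≡0 , _) agree =
      lookup-extensional λ j → val-injective (ℤP.i-j≡0⇒i≡j _ _ (kernel-supportedOnC≡0 z Az≡0
        (λ j j∉C → ℤP.i≡j⇒i-j≡0 (cong val (agree j j∉C))) j))
      where
      z : Fin m → ℤ
      z j = val (Vec.lookup x j) - val (Vec.lookup y j)
      expand : ∀ a u v → a * (u - v) ≡ a * u + (- 1ℤ) * (a * v)
      expand = solve-∀
      Az≡0 : ∀ i → sum (λ j → A i j * z j) ≡ 0ℤ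
      Az≡0 i = begin
        sum (λ j → A i j * z j)                       ≡⟨ sum-cong-≗ (λ j → expand (A i j) _ _) ⟩
        sum (λ j → Ax j + (- 1ℤ) * Ay j)              ≡⟨ ∑-distrib-+ Ax (λ j → (- 1ℤ) * Ay j) ⟩
        sum Ax + sum (λ j → (- 1ℤ) * Ay j)            ≡⟨ cong (sum Ax +_) (*-distribˡ-sum (- 1ℤ) Ay) ⟨
        sum Ax + (- 1ℤ) * sum Ay                      ≡⟨ cong₂ (λ a b → a + (- 1ℤ) * b)
                                                           (trans (sym (ΣFin≡sum m Ax)) (Ax≡0 i))
                                                           (trans (sym (ΣFin≡sum m Ay)) (Ay≡0 i)) ⟩
        0ℤ                                            ∎
        where
        open ≡-Reasoning
        Ax Ay : Fin m → ℤ
        Ax j = A i j * val (Vec.lookup x j)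
        Ay j = A i j * val (Vec.lookup y j)

open IntegerLinearAlgebra
open import Data.Nat using (_+_; _*_)

private variable A B : Set

lookup-injective : ∀ {xs : List A} → Unique xs → ∀ i j → List.lookup xs i ≡ List.lookup xs j → i ≡ j
lookup-injective (_ ∷ _)     fzero    fzero    _ = refl
lookup-injective (x∉ ∷ _)    fzero    (fsuc j) e = ⊥-elim (All.lookup x∉ (MP.∈-lookup j) e)
lookup-injective (x∉ ∷ _)    (fsuc i) fzero    e = ⊥-elim (All.lookup x∉ (MP.∈-lookup i) (sym e))
lookup-injective (_ ∷ uniq) (fsuc i) (fsuc j) e = cong fsuc (lookup-injective uniq i j e)

unique⊆⇒length≤ : ∀ {xs ys : List A} → Unique xs → xs ⊆ ys → length xs ≤ length ys
unique⊆⇒length≤ {xs = xs} {ys} uniq xs⊆ys = FP.injective⇒≤ {f = position} position-injective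
  where
  position : Fin (length xs) → Fin (length ys)
  position i = Any.index (xs⊆ys (MP.∈-lookup i))
  position-injective : ∀ {i j} → position i ≡ position j → i ≡ j
  position-injective {i} {j} e = lookup-injective uniq i j (begin
    List.lookup xs i                   ≡⟨ AnyP.lookup-index (xs⊆ys (MP.∈-lookup i)) ⟩
    List.lookup ys (position i)        ≡⟨ cong (List.lookup ys) e ⟩
    List.lookup ys (position j)        ≡⟨ AnyP.lookup-index (xs⊆ys (MP.∈-lookup j)) ⟨
    List.lookup xs j                   ∎)
    where open ≡-Reasoning

map-unique : (f : A → B) {xs : List A} → Unique xs →
             (∀ {x y} → x ∈ xs → y ∈ xs → f x ≡ f y → x ≡ y) → Unique (map f xs)
map-unique f []             _         = []
map-unique f {x ∷ xs} (x∉ ∷ uniq) injective =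
  AllP.map⁺ (All.tabulate λ y∈ e → All.lookup x∉ y∈ (injective (here refl) (there y∈) e))
  ∷ map-unique f uniq (λ x∈ y∈ → injective (there x∈) (there y∈))

injectiveOn⇒length≤ : (f : A → B) {xs : List A} {ys : List B} → Unique xs →
                      (∀ {x y} → x ∈ xs → y ∈ xs → f x ≡ f y → x ≡ y) →
                      (∀ {x} → x ∈ xs → f x ∈ ys) → length xs ≤ length ys
injectiveOn⇒length≤ f {xs} {ys} uniq injective into =
  subst (_≤ length ys) (LP.length-map f xs) (unique⊆⇒length≤ (map-unique f uniq injective) fxs⊆ys)
  where
  fxs⊆ys : map f xs ⊆ ys
  fxs⊆ys fx∈ with _ , x∈ , refl ← MP.∈-map⁻ f fx∈ = into x∈

∈-concatMap⁺ : ∀ (g : A → List B) {xs x y} → x ∈ xs → y ∈ g x → y ∈ concatMap g xs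
∈-concatMap⁺ g x∈ y∈ = MP.∈-concatMap⁺ g (Any.map (λ { refl → y∈ }) x∈)

length-concatMap≤ : ∀ (g : A → List B) {xs} T → (∀ {x} → x ∈ xs → length (g x) ≤ T) →
                    length (concatMap g xs) ≤ length xs * T
length-concatMap≤ g {[]}     T bounded = z≤n
length-concatMap≤ g {x ∷ xs} T bounded = begin
  length (g x ++ concatMap g xs)            ≡⟨ LP.length-++ (g x) ⟩
  length (g x) + length (concatMap g xs)  ≤⟨ ℕP.+-mono-≤ (bounded (here refl))
                                                  (length-concatMap≤ g T (bounded ∘ there)) ⟩
  T + length xs * T                      ∎
  where open ℕP.≤-Reasoning

length-concatMap≡ : ∀ (g : A → List B) xs c → (∀ x → length (g x) ≡ c) →
                    length (concatMap g xs) ≡ length xs * c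
length-concatMap≡ g []       c constant = refl
length-concatMap≡ g (x ∷ xs) c constant =
  trans (LP.length-++ (g x)) (cong₂ _+_ (constant x) (length-concatMap≡ g xs c constant))

length-allVecs : ∀ (xs : List A) m → length (allVecs xs m) ≡ length xs ^ m
length-allVecs xs zero    = refl
length-allVecs xs (suc m) = begin
  length (allVecs xs (suc m))        ≡⟨ length-concatMap≡ (λ v → map (Vec._∷ v) xs) (allVecs xs m) (length xs)
                                                          (λ v → LP.length-map (Vec._∷ v) xs) ⟩
  length (allVecs xs m) * length xs ≡⟨ cong (_* length xs) (length-allVecs xs m) ⟩
  length xs ^ m * length xs         ≡⟨ ℕP.*-comm (length xs ^ m) (length xs) ⟩
  length xs ^ suc m                   ∎
  where open ≡-Reasoning

∈-allVecs : ∀ (xs : List A) {m} (v : Vec A m) → (∀ i → Vec.lookup v i ∈ xs) → v ∈ allVecs xs m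
∈-allVecs xs Vec.[]       _       = here refl
∈-allVecs xs (a Vec.∷ v) entries∈ = ∈-concatMap⁺ (λ u → map (Vec._∷ u) xs)
  (∈-allVecs xs v (entries∈ ∘ fsuc)) (MP.∈-map⁺ (Vec._∷ v) (entries∈ fzero))

allVecs-unique : ∀ {xs : List A} → Unique xs → ∀ m → Unique (allVecs xs m)
allVecs-unique uniq zero    = [] ∷ []
allVecs-unique {xs = xs} uniq (suc m) = extend (allVecs-unique uniq m)
  where
  prepend : ∀ {m} → Vec _ m → List (Vec _ (suc m))
  prepend v = map (Vec._∷ v) xs
  tail-∈prepend : ∀ {m} {v : Vec _ m} {u} → u ∈ prepend v → Vec.tail u ≡ v
  tail-∈prepend {v = v} u∈ with _ , _ , refl ← MP.∈-map⁻ (Vec._∷ v) u∈ = refl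
  extend : ∀ {m} {vs : List (Vec _ m)} → Unique vs → Unique (concatMap prepend vs)
  extend []            = []
  extend {vs = v ∷ vs} (v∉ ∷ uniq-vs) =
    UniqueP.++⁺ (UniqueP.map⁺ VecP.∷-injectiveˡ uniq) (extend uniq-vs) λ (u∈v , u∈vs) →
      let (w , w∈vs , u∈w) = find (MP.∈-concatMap⁻ prepend u∈vs)
      in All.lookup v∉ w∈vs (trans (sym (tail-∈prepend u∈v)) (tail-∈prepend u∈w))

vectors : ∀ n m → List (Vec (Fin n) m)
vectors n = allVecs (allFin n)

length-vectors : ∀ n m → length (vectors n m) ≡ n ^ m
length-vectors n m = trans (length-allVecs (allFin n) m) (cong (_^ m) (LP.length-tabulate (λ i → i)))

∈-vectors : ∀ {n m} (v : Vec (Fin n) m) → v ∈ vectors n m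
∈-vectors v = ∈-allVecs (allFin _) v (λ i → MP.∈-allFin _)

vectors-unique : ∀ n m → Unique (vectors n m)
vectors-unique n = allVecs-unique (UniqueP.allFin⁺ n)

length≤-byFibres : ∀ {K : Set} (_≟_ : DecidableEquality K) (key : A → K) (keys : List K) {xs : List A} T →
  Unique xs → (∀ {x} → x ∈ xs → key x ∈ keys) →
  (∀ κ → length (filter (λ x → key x ≟ κ) xs) ≤ T) → length xs ≤ length keys * T
length≤-byFibres _≟_ key keys {xs} T uniq keyed fibre≤ = begin
  length xs                          ≤⟨ unique⊆⇒length≤ uniq xs⊆fibres ⟩
  length (concatMap fibre keys)      ≤⟨ length-concatMap≤ fibre {keys} T (λ {κ} _ → fibre≤ κ) ⟩
  length keys * T                   ∎
  where
  open ℕP.≤-Reasoning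
  fibre : _ → List _
  fibre κ = filter (λ x → key x ≟ κ) xs
  xs⊆fibres : xs ⊆ concatMap fibre keys
  xs⊆fibres x∈ = ∈-concatMap⁺ fibre (keyed x∈) (MP.∈-filter⁺ (λ y → key y ≟ _) x∈ refl)

≤-maximum : ∀ {x} xs → x ∈ xs → x ≤ maximum xs
≤-maximum (y ∷ xs) (here refl) = ℕP.m≤m⊔n y (maximum xs)
≤-maximum (y ∷ xs) (there x∈)  = ℕP.≤-trans (≤-maximum xs x∈) (ℕP.m≤n⊔m y (maximum xs))

maximum≡0⊎∈ : ∀ xs → maximum xs ≡ 0 ⊎ maximum xs ∈ xs
maximum≡0⊎∈ []       = inj₁ refl
maximum≡0⊎∈ (y ∷ xs) with ℕP.⊔-sel y (maximum xs)
... | inj₁ max≡y = inj₂ (here max≡y)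
... | inj₂ max≡max with maximum≡0⊎∈ xs
...   | inj₁ max≡0 = inj₁ (trans max≡max max≡0)
...   | inj₂ max∈  = inj₂ (there (subst (_∈ xs) (sym max≡max) max∈))

elements : ∀ {n} → Subset n → List (Fin n)
elements Vec.[]           = []
elements (true  Vec.∷ p) = fzero ∷ map fsuc (elements p)
elements (false Vec.∷ p) = map fsuc (elements p)

length-elements : ∀ {n} (p : Subset n) → length (elements p) ≡ ∣ p ∣
length-elements Vec.[]           = refl
length-elements (true  Vec.∷ p) = cong suc (trans (LP.length-map fsuc (elements p)) (length-elements p))
length-elements (false Vec.∷ p) = trans (LP.length-map fsuc (elements p)) (length-elements p)

∈-elements⁺ : ∀ {n} (p : Subset n) {x} → x ∈ₛ p → x ∈ elements p
∈-elements⁺ (true  Vec.∷ p) Vec.here        = here refl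
∈-elements⁺ (true  Vec.∷ p) (Vec.there x∈) = there (MP.∈-map⁺ fsuc (∈-elements⁺ p x∈))
∈-elements⁺ (false Vec.∷ p) (Vec.there x∈) = MP.∈-map⁺ fsuc (∈-elements⁺ p x∈)

∈-elements⁻ : ∀ {n} (p : Subset n) {x} → x ∈ elements p → x ∈ₛ p
∈-elements⁻ (true  Vec.∷ p) (here refl) = Vec.here
∈-elements⁻ (true  Vec.∷ p) (there x∈) with _ , y∈ , refl ← MP.∈-map⁻ fsuc x∈ = Vec.there (∈-elements⁻ p y∈)
∈-elements⁻ (false Vec.∷ p) x∈         with _ , y∈ , refl ← MP.∈-map⁻ fsuc x∈ = Vec.there (∈-elements⁻ p y∈)

elements-unique : ∀ {n} (p : Subset n) → Unique (elements p)
elements-unique Vec.[]           = []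
elements-unique (true  Vec.∷ p) =
  All.tabulate (λ y∈ 0≡y → 0∉suc (subst (_∈ map fsuc (elements p)) (sym 0≡y) y∈))
  ∷ UniqueP.map⁺ FP.suc-injective (elements-unique p)
  where
  0∉suc : fzero ∉ map fsuc (elements p)
  0∉suc 0∈ with _ , _ , () ← MP.∈-map⁻ fsuc 0∈
elements-unique (false Vec.∷ p) = UniqueP.map⁺ FP.suc-injective (elements-unique p)

T-does⇒ : ∀ {P : Set} (P? : Dec P) → T (does P?) → P
T-does⇒ (yes p) _ = p

T-not-does⇒ : ∀ {P : Set} (P? : Dec P) → T (not (does P?)) → ¬ P
T-not-does⇒ (no ¬p) _ = ¬p

_∈?_ : ∀ {n} (j : Fin n) xs → Dec (j ∈ xs)
j ∈? xs = Any.any? (j FP.≟_) xs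

fromList : ∀ {n} → List (Fin n) → Subset n
fromList xs = Vec.tabulate (λ j → does (j ∈? xs))

∈-fromList⁺ : ∀ {n} {xs : List (Fin n)} {j} → j ∈ xs → j ∈ₛ fromList xs
∈-fromList⁺ {xs = xs} {j} j∈ =
  VecP.lookup⇒[]= j _ (trans (VecP.lookup∘tabulate (λ j → does (j ∈? xs)) j) (dec-true (j ∈? xs) j∈))

∈-fromList⁻ : ∀ {n} {xs : List (Fin n)} {j} → j ∈ₛ fromList xs → j ∈ xs
∈-fromList⁻ {xs = xs} {j} j∈ = T-does⇒ (j ∈? xs) (Equivalence.from T-≡
  (trans (sym (VecP.lookup∘tabulate (λ j → does (j ∈? xs)) j)) (VecP.[]=⇒lookup j∈)))

∣fromList∣ : ∀ {n} {xs : List (Fin n)} → Unique xs → ∣ fromList xs ∣ ≡ length xs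
∣fromList∣ {xs = xs} uniq = trans (sym (length-elements (fromList xs))) (ℕP.≤-antisym
  (unique⊆⇒length≤ {ys = xs} (elements-unique (fromList xs)) (∈-fromList⁻ ∘ ∈-elements⁻ (fromList xs)))
  (unique⊆⇒length≤ uniq (∈-elements⁺ (fromList xs) ∘ ∈-fromList⁺)))

record NonzeroMinor {r m} (A : Matrix r m) (S : Subset m) (k : ℕ) : Set where
  field
    rows   : Vec (Fin r) k
    cols   : Vec (Fin m) k
    cols∈S : ∀ t → Vec.lookup cols t ∈ₛ S
    det≢0  : det k (minor k A rows cols) ≢ 0ℤ

hasNonzeroMinor⇒NonzeroMinor : ∀ {r m} (A : Matrix r m) S k → T (hasNonzeroMinor A S k) → NonzeroMinor A S k
hasNonzeroMinor⇒NonzeroMinor {r} {m} A S k witnessed =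
  let (rows , _ , witnessed′) = find (AnyP.any⁻ _ (vectors r k) witnessed)
      (cols , _ , nonzero)    = find (AnyP.any⁻ _ (vectors m k) witnessed′)
      (cols∈S , det≢0)        = Equivalence.to T-∧ nonzero
  in record { rows   = rows
            ; cols   = cols
            ; cols∈S = T-does⇒ (FP.all? (λ j → Vec.lookup cols j ∈ₛ? S)) cols∈S
            ; det≢0  = T-not-does⇒ (det k (minor k A rows cols) ℤ.≟ 0ℤ) det≢0 }

rankCols-NonzeroMinor : ∀ {r m} (A : Matrix r m) S → NonzeroMinor A S (rankCols A S)
rankCols-NonzeroMinor {m = m} A S with maximum≡0⊎∈ (filter (λ k → T? (hasNonzeroMinor A S k)) (List.upTo (suc m)))
-- For rank 0 the empty minor (determinant 1) is found by evaluation.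
... | inj₁ rank≡0 = subst (NonzeroMinor A S) (sym rank≡0) (hasNonzeroMinor⇒NonzeroMinor A S 0 _)
... | inj₂ rank∈  = hasNonzeroMinor⇒NonzeroMinor A S (rankCols A S)
                      (proj₂ (MP.∈-filter⁻ (λ k → T? (hasNonzeroMinor A S k)) {xs = List.upTo (suc m)} rank∈))

module AgreeingOn {r m} (A : Matrix r m) {k} (R : Vec (Fin r) k) (C : Vec (Fin m) k)
  (det≢0 : det k (minor k A R C) ≢ 0ℤ) (P : List (Fin m)) (P-unique : Unique P) (C∉P : ∀ t → Vec.lookup C t ∉ P) where

  open ThroughNonsingularMinor A R C det≢0

  free? : (j : Fin m) → Dec (j ∉ P × ¬ (∃ λ t → Vec.lookup C t ≡ j))
  free? j = ¬? (j ∈? P) ×-dec ¬? (FP.any? (λ t → Vec.lookup C t FP.≟ j))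

  free : List (Fin m)
  free = filter free? (allFin m)

  free+P+k≤m : length free + (length P + k) ≤ m
  free+P+k≤m = subst₂ _≤_ lengths (LP.length-tabulate id)
    (unique⊆⇒length≤ partition-unique (λ _ → MP.∈-allFin _))
    where
    Cs : List (Fin m)
    Cs = List.tabulate (Vec.lookup C)
    lengths : length (free ++ P ++ Cs) ≡ length free + (length P + k)
    lengths = trans (LP.length-++ free) (cong (length free +_)
                (trans (LP.length-++ P) (cong (length P +_) (LP.length-tabulate (Vec.lookup C)))))
    P∩Cs≡∅ : Disjoint P Cs
    P∩Cs≡∅ (j∈P , j∈Cs) with t , refl ← MP.∈-tabulate⁻ j∈Cs = C∉P t j∈P
    free∩PCs≡∅ : Disjoint free (P ++ Cs)
    free∩PCs≡∅ (j∈free , j∈PCs) with _ , (j∉P , j∉C) ← MP.∈-filter⁻ free? {xs = allFin m} j∈free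
      with MP.∈-++⁻ P j∈PCs
    ... | inj₁ j∈P  = j∉P j∈P
    ... | inj₂ j∈Cs with t , j≡Ct ← MP.∈-tabulate⁻ j∈Cs = j∉C (t , sym j≡Ct)
    partition-unique : Unique (free ++ P ++ Cs)
    partition-unique = UniqueP.++⁺ (UniqueP.filter⁺ free? (UniqueP.allFin⁺ m))
      (UniqueP.++⁺ P-unique (UniqueP.tabulate⁺ C-injective) P∩Cs≡∅) free∩PCs≡∅

  agreeingSolutions≤ : ∀ {n} (Fs : List (Vec (Fin n) m)) → Unique Fs → (∀ {x} → x ∈ Fs → IsProperSolution A x) →
    (∀ {x y} → x ∈ Fs → y ∈ Fs → ∀ {p} → p ∈ P → Vec.lookup x p ≡ Vec.lookup y p) →
    length Fs ≤ n ^ length free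
  agreeingSolutions≤ {n} Fs Fs-unique solves agreeOnP =
    subst (length Fs ≤_) (length-vectors n (length free))
      (injectiveOn⇒length≤ restrict Fs-unique restrict-injective (λ _ → ∈-vectors _))
    where
    restrict : Vec (Fin n) m → Vec (Fin n) (length free)
    restrict x = Vec.tabulate (λ i → Vec.lookup x (List.lookup free i))
    restrict-injective : ∀ {x y} → x ∈ Fs → y ∈ Fs → restrict x ≡ restrict y → x ≡ y
    restrict-injective {x} {y} x∈ y∈ restrict≡ = solutions-agreeingOffC (solves x∈) (solves y∈) agreeOffC
      where
      agreeOnFree : ∀ {j} → j ∈ free → Vec.lookup x j ≡ Vec.lookup y j
      agreeOnFree j∈ = subst (λ j → Vec.lookup x j ≡ Vec.lookup y j) (sym (AnyP.lookup-index j∈)) (begin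
        Vec.lookup x (List.lookup free (Any.index j∈))    ≡⟨ VecP.lookup∘tabulate _ (Any.index j∈) ⟨
        Vec.lookup (restrict x) (Any.index j∈)            ≡⟨ cong (λ v → Vec.lookup v (Any.index j∈)) restrict≡ ⟩
        Vec.lookup (restrict y) (Any.index j∈)            ≡⟨ VecP.lookup∘tabulate _ (Any.index j∈) ⟩
        Vec.lookup y (List.lookup free (Any.index j∈))    ∎)
        where open ≡-Reasoning
      agreeOffC : ∀ j → (∀ t → Vec.lookup C t ≢ j) → Vec.lookup x j ≡ Vec.lookup y j
      agreeOffC j j∉C with j ∈? P
      ... | yes j∈P = agreeOnP x∈ y∈ j∈P
      ... | no  j∉P = agreeOnFree (MP.∈-filter⁺ free? (MP.∈-allFin j) (j∉P , λ (t , Ct≡j) → j∉C t Ct≡j))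

exponent-lowerBound : ∀ {m ρ p κ d} → d + (p + κ) ≤ m → ρ ∸ κ ≤ p → d ≤ (m ∸ ρ) ∸ (p ∸ (ρ ∸ κ))
exponent-lowerBound {m} {ρ} {p} {κ} {d} count ρ∸κ≤p =
  subst (d ≤_) (sym (ℕP.∸-+-assoc m ρ (p ∸ (ρ ∸ κ))))
    (ℕP.m+n≤o⇒m≤o∸n d (ℕP.≤-trans (ℕP.+-monoʳ-≤ d ρ+[p∸[ρ∸κ]]≤p+κ) count))
  where
  open ℕP.≤-Reasoning
  ρ+[p∸[ρ∸κ]]≤p+κ : ρ + (p ∸ (ρ ∸ κ)) ≤ p + κ
  ρ+[p∸[ρ∸κ]]≤p+κ = begin
    ρ + (p ∸ (ρ ∸ κ))                  ≤⟨ ℕP.+-monoˡ-≤ (p ∸ (ρ ∸ κ)) (ℕP.m≤n+m∸n ρ κ) ⟩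
    κ + (ρ ∸ κ) + (p ∸ (ρ ∸ κ))      ≡⟨ ℕP.+-assoc κ (ρ ∸ κ) (p ∸ (ρ ∸ κ)) ⟩
    κ + ((ρ ∸ κ) + (p ∸ (ρ ∸ κ)))    ≡⟨ cong (κ +_) (ℕP.m+[n∸m]≡n ρ∸κ≤p) ⟩
    κ + p                              ≡⟨ ℕP.+-comm κ p ⟩
    p + κ                              ∎

exponent-lowerBound-fullRank : ∀ {m ρ p κ d} → d + ρ ≤ m → p ≤ ρ ∸ κ → d ≤ (m ∸ ρ) ∸ (p ∸ (ρ ∸ κ))
exponent-lowerBound-fullRank {m} {ρ} {p} {κ} {d} count p≤ρ∸κ =
  subst (λ e → d ≤ (m ∸ ρ) ∸ e) (sym (ℕP.m≤n⇒m∸n≡0 p≤ρ∸κ)) (ℕP.m+n≤o⇒m≤o∸n d count)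

agreeingSolutions≤term : ∀ {r m n} (A : Matrix r (suc m)) (P : List (Fin (suc m))) → Unique P →
  (Fs : List (Vec (Fin n) (suc m))) → Unique Fs → (∀ {x} → x ∈ Fs → IsProperSolution A x) →
  (∀ {x y} → x ∈ Fs → y ∈ Fs → ∀ {p} → p ∈ P → Vec.lookup x p ≡ Vec.lookup y p) →
  length Fs ≤ n ^ ((suc m ∸ rank A) ∸ (length P ∸ rQ A (fromList P)))
agreeingSolutions≤term A P P-unique []            _         _      _     = z≤n
agreeingSolutions≤term {m = m} {n} A P P-unique Fs@(x ∷ _) Fs-unique solves agree =
  let (d , d≤e , bound) = viaMinor (length P ℕP.≤? rank A ∸ rankCols A (∁ Q))
  in ℕP.≤-trans bound (ℕP.^-monoʳ-≤ n {{FP.nonZeroIndex (Vec.head x)}} d≤e)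
  where
  Q : Subset (suc m)
  Q = fromList P
  minor⊤ : NonzeroMinor A ⊤ (rank A)
  minor⊤ = rankCols-NonzeroMinor A ⊤
  minorOffQ : NonzeroMinor A (∁ Q) (rankCols A (∁ Q))
  minorOffQ = rankCols-NonzeroMinor A (∁ Q)
  module Full = AgreeingOn A (NonzeroMinor.rows minor⊤) (NonzeroMinor.cols minor⊤)
                  (NonzeroMinor.det≢0 minor⊤) [] [] (λ _ ())
  module OffQ = AgreeingOn A (NonzeroMinor.rows minorOffQ) (NonzeroMinor.cols minorOffQ)
                  (NonzeroMinor.det≢0 minorOffQ) P P-unique
                  (λ t t∈P → x∈∁p⇒x∉p (NonzeroMinor.cols∈S minorOffQ t) (∈-fromList⁺ t∈P))
  -- If ℓ ≤ r_Q the exponent is m − rank A, given directly by a maximal minor of A (sparing a proof of r_Q ≤ ℓ).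
  viaMinor : Dec (length P ≤ rank A ∸ rankCols A (∁ Q)) →
    ∃ λ d → d ≤ (suc m ∸ rank A) ∸ (length P ∸ rQ A Q) × length Fs ≤ n ^ d
  viaMinor (yes P≤ρ∸κ) = length Full.free , exponent-lowerBound-fullRank {κ = rankCols A (∁ Q)} Full.free+P+k≤m P≤ρ∸κ
                        , Full.agreeingSolutions≤ Fs Fs-unique solves (λ _ _ ())
  viaMinor (no P≰ρ∸κ)  = length OffQ.free , exponent-lowerBound {ρ = rank A} OffQ.free+P+k≤m (ℕP.<⇒≤ (ℕP.≰⇒> P≰ρ∸κ))
                        , OffQ.agreeingSolutions≤ Fs Fs-unique solves agree

term≤maxTerm : ∀ {r m} (A : Matrix r m) n ℓ (Q : Subset m) → ∣ Q ∣ ≡ ℓ →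
  n ^ ((m ∸ rank A) ∸ (∣ Q ∣ ∸ rQ A Q)) ≤ maxTerm A n ℓ
term≤maxTerm A n ℓ Q ∣Q∣≡ℓ = ≤-maximum _ (MP.∈-map⁺ (λ Q → n ^ ((_ ∸ rank A) ∸ (∣ Q ∣ ∸ rQ A Q)))
  (MP.∈-filter⁺ (λ Q → ∣ Q ∣ ℕ.≟ ℓ) (∈-allVecs (true ∷ false ∷ []) Q (bool∈ ∘ Vec.lookup Q)) ∣Q∣≡ℓ))
  where
  bool∈ : ∀ b → b ∈ true ∷ false ∷ []
  bool∈ true  = here refl
  bool∈ false = there (here refl)

module Degree {r m} (A : Matrix r (suc m)) (n ℓ : ℕ) (B : Subset n) (∣B∣≡ℓ : ∣ B ∣ ≡ ℓ) where

  edges : List (Vec (Fin n) (suc m))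
  edges = filter (edgeContains? B) (filter (properSolution? A) (vectors n (suc m)))

  edges-unique : Unique edges
  edges-unique = UniqueP.filter⁺ (edgeContains? B) (UniqueP.filter⁺ (properSolution? A) (vectors-unique n (suc m)))

  ∈edges⇒ : ∀ {x} → x ∈ edges → IsProperSolution A x × EdgeContains x B
  ∈edges⇒ x∈ =
    let (x∈solutions , contains) = MP.∈-filter⁻ (edgeContains? B) {xs = filter (properSolution? A) (vectors n (suc m))} x∈
    in proj₂ (MP.∈-filter⁻ (properSolution? A) {xs = vectors n (suc m)} x∈solutions) , contains

  position : Vec (Fin n) (suc m) → Fin n → Fin (suc m)
  position x v with FP.any? (λ j → Vec.lookup x j FP.≟ v)
  ... | yes (j , _) = j
  ... | no  _       = fzero  -- junk value: v does not occur in x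

  lookup-position : ∀ x v → (∃ λ j → Vec.lookup x j ≡ v) → Vec.lookup x (position x v) ≡ v
  lookup-position x v v∈x with FP.any? (λ j → Vec.lookup x j FP.≟ v)
  ... | yes (_ , x[j]≡v) = x[j]≡v
  ... | no  v∉x          = ⊥-elim (v∉x v∈x)

  elementsB : List (Fin n)
  elementsB = elements B

  positions : Vec (Fin n) (suc m) → Vec (Fin (suc m)) (length elementsB)
  positions x = Vec.tabulate (λ i → position x (List.lookup elementsB i))

  lookup-position-edge : ∀ {x} → x ∈ edges → ∀ {v} → v ∈ elementsB → Vec.lookup x (position x v) ≡ v
  lookup-position-edge {x} x∈ {v} v∈ = lookup-position x v (proj₂ (∈edges⇒ x∈) v (∈-elements⁻ B v∈))

  position-cong : ∀ {x y} → positions x ≡ positions y → ∀ {v} → v ∈ elementsB → position x v ≡ position y v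
  position-cong {x} {y} positions≡ v∈ = subst (λ v → position x v ≡ position y v) (sym (AnyP.lookup-index v∈)) (begin
    position x (List.lookup elementsB (Any.index v∈))   ≡⟨ VecP.lookup∘tabulate _ (Any.index v∈) ⟨
    Vec.lookup (positions x) (Any.index v∈)             ≡⟨ cong (λ κ → Vec.lookup κ (Any.index v∈)) positions≡ ⟩
    Vec.lookup (positions y) (Any.index v∈)             ≡⟨ VecP.lookup∘tabulate _ (Any.index v∈) ⟩
    position y (List.lookup elementsB (Any.index v∈))   ∎)
    where open ≡-Reasoning

  sameFibre≤ : ∀ Fs → Unique Fs → (∀ {x} → x ∈ Fs → x ∈ edges) →
    (∀ {x y} → x ∈ Fs → y ∈ Fs → positions x ≡ positions y) → length Fs ≤ maxTerm A n ℓ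
  sameFibre≤ []          _         _      _             = z≤n
  sameFibre≤ Fs@(x₀ ∷ _) Fs-unique ⊆edges samePositions = begin
    length Fs                                        ≤⟨ agreeingSolutions≤term A P P-unique Fs Fs-unique
                                                          (proj₁ ∘ ∈edges⇒ ∘ ⊆edges) agree ⟩
    n ^ ((suc m ∸ rank A) ∸ (length P ∸ rQ A Q))     ≡⟨ cong (λ p → n ^ ((suc m ∸ rank A) ∸ (p ∸ rQ A Q))) ∣Q∣≡∣P∣ ⟨
    n ^ ((suc m ∸ rank A) ∸ (∣ Q ∣ ∸ rQ A Q))        ≤⟨ term≤maxTerm A n ℓ Q (trans ∣Q∣≡∣P∣ ∣P∣≡ℓ) ⟩
    maxTerm A n ℓ                                    ∎
    where
    open ℕP.≤-Reasoning
    P : List (Fin (suc m))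
    P = map (position x₀) elementsB
    Q : Subset (suc m)
    Q = fromList P
    x₀∈edges : x₀ ∈ edges
    x₀∈edges = ⊆edges (here refl)
    P-unique : Unique P
    P-unique = map-unique (position x₀) (elements-unique B) λ v∈ w∈ pv≡pw →
      trans (sym (lookup-position-edge x₀∈edges v∈))
            (trans (cong (Vec.lookup x₀) pv≡pw) (lookup-position-edge x₀∈edges w∈))
    at-position : ∀ {x} → x ∈ Fs → ∀ {v} → v ∈ elementsB → Vec.lookup x (position x₀ v) ≡ v
    at-position {x} x∈ v∈ = trans (cong (Vec.lookup x) (position-cong {x₀} {x} (samePositions (here refl) x∈) v∈))
                              (lookup-position-edge (⊆edges x∈) v∈)
    agree : ∀ {x y} → x ∈ Fs → y ∈ Fs → ∀ {p} → p ∈ P → Vec.lookup x p ≡ Vec.lookup y p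
    agree x∈ y∈ p∈ with _ , v∈ , refl ← MP.∈-map⁻ (position x₀) p∈ = trans (at-position x∈ v∈) (sym (at-position y∈ v∈))
    ∣Q∣≡∣P∣ : ∣ Q ∣ ≡ length P
    ∣Q∣≡∣P∣ = ∣fromList∣ P-unique
    ∣P∣≡ℓ : length P ≡ ℓ
    ∣P∣≡ℓ = trans (LP.length-map (position x₀) elementsB) (trans (length-elements B) ∣B∣≡ℓ)

  _≟κ_ : DecidableEquality (Vec (Fin (suc m)) (length elementsB))
  _≟κ_ = VecP.≡-dec FP._≟_

  fibre≤ : ∀ κ → length (filter (λ x → positions x ≟κ κ) edges) ≤ maxTerm A n ℓ
  fibre≤ κ = sameFibre≤ (filter (λ x → positions x ≟κ κ) edges) (UniqueP.filter⁺ _ edges-unique)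
    (proj₁ ∘ inFibre) (λ x∈ y∈ → trans (proj₂ (inFibre x∈)) (sym (proj₂ (inFibre y∈))))
    where
    inFibre : ∀ {x} → x ∈ filter (λ x → positions x ≟κ κ) edges → x ∈ edges × positions x ≡ κ
    inFibre = MP.∈-filter⁻ (λ x → positions x ≟κ κ) {xs = edges}

  deg≤ : deg A n B ≤ (suc m) ^ ℓ * maxTerm A n ℓ
  deg≤ = subst (λ c → deg A n B ≤ c * maxTerm A n ℓ)
    (trans (length-vectors (suc m) (length elementsB)) (cong (suc m ^_) (trans (length-elements B) ∣B∣≡ℓ)))
    (length≤-byFibres _≟κ_ positions (vectors (suc m) (length elementsB)) (maxTerm A n ℓ)
      edges-unique (λ _ → ∈-vectors _) fibre≤)

lemma3p1 : ∀ {r m} (A : Matrix r m) (n ℓ : ℕ) → 1 ≤ ℓ → ℓ ≤ m →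
    (B : Subset n) → ∣ B ∣ ≡ ℓ →
    deg A n B ≤ (ℓ !) * (m ^ ℓ) * maxTerm A n ℓ
-- The hypotheses 1 ≤ ℓ ≤ m only serve to exclude m = 0.
lemma3p1 {m = zero}  _ _ _ 1≤ℓ ℓ≤0 _ _ = ⊥-elim (ℕP.<⇒≢ (ℕP.≤-trans 1≤ℓ ℓ≤0) refl)
lemma3p1 {m = suc m} A n ℓ _   _   B ∣B∣≡ℓ = ℕP.≤-trans (Degree.deg≤ A n ℓ B ∣B∣≡ℓ)
  (ℕP.*-monoˡ-≤ (maxTerm A n ℓ) (ℕP.m≤n*m (suc m ^ ℓ) (ℓ !) {{ℓ ℕP.!≢0}}))
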